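{- A connected graph $G$ is direct-topfull if and only if for any two vertices $u,v\in V(G)$ there exists a $u,v$-path $P$ in $G$ such that every edge of $P$ belongs to a member of some vertex-disjoint cycle/edge cover of $G$ (the cover may depend on the edge).
   Context: Graphs are finite, simple and undirected; $d_G$ denotes shortest-path distance. For an integer $\ell\ge0$, an $\ell$-track on $G$ is a surjective function $f:\{0,\dots,\ell\}\to V(G)$ with $f(i)f(i+1)\in E(G)$ for all $0\le i<\ell$. For a family $F=\{f_1,\dots,f_p\}$ of functions $\{0,\dots,\ell\}\to V(G)$ with $p\ge 2$, $m_G(F)=\min_{i\ne j}\min_t d_G(f_i(t),f_j(t))$. An $\ell$-tour is a family of $\ell$-tracks. The direct $1$-capacity $\mathrm{cap}^\times_1(G)$ (for non-trivial $G$) is the maximum $c$ such that there is an $\ell$-tour $F=\{f_1,\dots,f_c\}$ on $G$ (for some $\ell$) with $m_G(F)=1$. A connected graph on $n$ vertices is direct-topfull if $\mathrm{cap}^\times_1(G)=n$. A vertex-disjoint cycle/edge cover of $G$ is a set $S$ of subgraphs of $G$, each a cycle or isomorphic to $K_2$, such that every vertex of $G$ lies in some member of $S$ and distinct members of $S$ share no vertex. -}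

module Defs where

open import Data.Nat using (ℕ; zero; suc; _+_; _≤_; _<_)
open import Data.Nat.DivMod using (_%_; m%n<n)
open import Data.Fin using (Fin; toℕ; fromℕ<; inject₁) renaming (zero to fzero; suc to fsuc)
open import Data.Bool using (Bool; true; false)
open import Data.Product using (Σ; ∃; ∃-syntax; _×_; _,_)
open import Data.Sum using (_⊎_)
open import Relation.Binary.PropositionalEquality using (_≡_; _≢_)
open import Relation.Nullary using (¬_)
open import Function.Definitions using (Injective; Surjective)

record Graph : Set where
  field
    n      : ℕ
    adj    : Fin n → Fin n → Bool
    sym    : ∀ u v → adj u v ≡ adj v u
    irrefl : ∀ v → adj v v ≡ false

open Graph public

V : Graph → Set
V G = Fin (n G)

Adj : (G : Graph) → V G → V G → Set
Adj G u v = adj G u v ≡ true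

Walk : (G : Graph) → V G → V G → ℕ → Set
Walk G u v k =
  Σ (Fin (suc k) → V G) λ w →
    (w fzero ≡ u) × (w (Data.Fin.fromℕ k) ≡ v) ×
    (∀ (i : Fin k) → Adj G (w (inject₁ i)) (w (fsuc i)))

Connected : Graph → Set
Connected G = ∀ (u v : V G) → ∃[ k ] Walk G u v k

IsDist : (G : Graph) → V G → V G → ℕ → Set
IsDist G u v d = Walk G u v d × (∀ k → Walk G u v k → d ≤ k)

Path : (G : Graph) → V G → V G → ℕ → Set
Path G u v k =
  Σ (Fin (suc k) → V G) λ w →
    Injective _≡_ _≡_ w × (w fzero ≡ u) × (w (Data.Fin.fromℕ k) ≡ v) ×
    (∀ (i : Fin k) → Adj G (w (inject₁ i)) (w (fsuc i)))

Track : Graph → ℕ → Set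
Track G ℓ =
  Σ (Fin (suc ℓ) → V G) λ f →
    Surjective _≡_ _≡_ f × (∀ (i : Fin ℓ) → Adj G (f (inject₁ i)) (f (fsuc i)))

MinDist : (G : Graph) {p ℓ : ℕ} → (Fin p → Fin (suc ℓ) → V G) → ℕ → Set
MinDist G {p} {ℓ} F m =
  (∀ (i j : Fin p) → i ≢ j → ∀ (t : Fin (suc ℓ)) (d : ℕ) →
      IsDist G (F i t) (F j t) d → m ≤ d) ×
  (∃[ i ] ∃[ j ] (i ≢ j × ∃[ t ] IsDist G (F i t) (F j t) m))

Achievable1 : Graph → ℕ → Set
Achievable1 G c =
  (2 ≤ c) ×
  ∃[ ℓ ] Σ (Fin c → Track G ℓ) λ F →
    MinDist G (λ i → Data.Product.proj₁ (F i)) 1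

IsCap1 : Graph → ℕ → Set
IsCap1 G c = Achievable1 G c × (∀ c' → Achievable1 G c' → c' ≤ c)

DirectTopfull : Graph → Set
DirectTopfull G = Connected G × IsCap1 G (n G)

next : {k : ℕ} → Fin (suc k) → Fin (suc k)
next {k} i = fromℕ< (m%n<n (suc (toℕ i)) (suc k))

-- A member of a cover: a subgraph that is a K₂ (an edge) or a cycle
-- (given by its cyclic vertex sequence c 0, ..., c (k+2), pairwise distinct).
data Piece (G : Graph) : Set where
  edgeP  : (u v : V G) → Adj G u v → Piece G
  cycleP : (k : ℕ) (c : Fin (3 + k) → V G) → Injective _≡_ _≡_ c →
           (∀ i → Adj G (c i) (c (next i))) → Piece G

VertexOf : {G : Graph} → Piece G → V G → Set
VertexOf (edgeP u v _) x = (x ≡ u) ⊎ (x ≡ v)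
VertexOf (cycleP k c _ _) x = ∃[ i ] c i ≡ x

EdgeOf : {G : Graph} → Piece G → V G → V G → Set
EdgeOf (edgeP u v _) x y = ((x ≡ u) × (y ≡ v)) ⊎ ((x ≡ v) × (y ≡ u))
EdgeOf (cycleP k c _ _) x y =
  ∃[ i ] (((c i ≡ x) × (c (next i) ≡ y)) ⊎ ((c i ≡ y) × (c (next i) ≡ x)))

record Cover (G : Graph) : Set where
  field
    m        : ℕ
    piece    : Fin m → Piece G
    covering : ∀ (x : V G) → ∃[ i ] VertexOf (piece i) x
    disjoint : ∀ (i j : Fin m) (x : V G) →
               VertexOf (piece i) x → VertexOf (piece j) x → i ≡ j

EdgeInSomeCover : (G : Graph) → V G → V G → Set
EdgeInSomeCover G x y =
  Σ (Cover G) λ S → ∃[ i ] EdgeOf (Cover.piece S i) x y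

CoverPathProperty : Graph → Set
CoverPathProperty G =
  ∀ (u v : V G) → ∃[ k ] Σ (Path G u v k) λ P →
    ∀ (i : Fin k) →
      EdgeInSomeCover G (Data.Product.proj₁ P (inject₁ i)) (Data.Product.proj₁ P (fsuc i))

-- A move (an injective map sending every vertex to a neighbour) is a cycle/edge cover
-- traversed in one direction: its orbits are edges or cycles, and conversely every
-- vertex-disjoint cycle/edge cover can be rotated.  In a tour with m_G = 1 the robots sit
-- on distinct vertices at every time, so from one time to the next they perform a move;
-- every step of a track is therefore an edge of some cover, and since a track visits all
-- vertices it joins any two of them by a walk of such edges, which shortens to a path.
-- Conversely, each edge of such a path is traversed by a rotation of its cover or by the
-- inverse rotation.  Concatenating, for every start a and target v, moves that bring the
-- current position of a to v gives a schedule in which every robot visits every vertex;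
-- moves keep the robots on distinct vertices, and two robots starting on an edge are at
-- distance exactly 1.  No tour has more than n tracks, as they start on distinct vertices.
module Submission where

open import Level using (0ℓ)
open import Data.Nat
  using (ℕ; zero; suc; _+_; _∸_; _*_; _≤_; _<_; z≤n; s≤s; z<s; NonZero; >-nonZero)
open import Data.Nat.Properties hiding (suc-injective)
open import Data.Nat.DivMod
  using (_%_; _/_; m≡m%n+[m/n]*n; m%n<n; %-distribˡ-+; [m+n]%n≡m%n; m<n⇒m%n≡m)
open import Data.Nat.GeneralisedArithmetic using (fold; fold-+)
open import Data.Fin using (Fin; toℕ; fromℕ; fromℕ<; inject₁; punchOut)
  renaming (zero to fzero; suc to fsuc)
open import Data.Fin.Properties
  using (toℕ-injective; toℕ-fromℕ<; toℕ-inject; toℕ-inject₁; toℕ<n; ¬∀⟶∃¬-smallest;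
         pigeonhole; punchOut-injective; any?; injective⇒≤)
  renaming (_≟_ to _≟ᶠ_; <⇒≢ to <⇒≢ᶠ; suc-injective to fsuc-injective)
open import Data.List
  using (List; []; _∷_; _++_; lookup; filter; allFin; length; cartesianProduct)
open import Data.List.Properties using (length-++)
open import Data.List.Relation.Unary.Any using (index; here; there)
open import Data.List.Relation.Unary.Any.Properties using (lookup-result)
open import Data.List.Relation.Unary.All as All using ()
open import Data.List.Relation.Unary.AllPairs using (_∷_)
open import Data.List.Relation.Unary.Unique.Propositional using (Unique)
open import Data.List.Relation.Unary.Unique.Propositional.Properties using (filter⁺; allFin⁺)
open import Data.List.Membership.Propositional using (_∈_)
open import Data.List.Membership.Propositional.Properties
  using (∈-lookup; ∈-filter⁺; ∈-filter⁻; ∈-allFin; ∈-cartesianProduct⁺)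
open import Data.Product using (Σ; ∃; ∃₂; ∃-syntax; _×_; _,_; proj₁; proj₂)
open import Data.Sum using (_⊎_; inj₁; inj₂)
open import Function using (_∘_; id)
open import Function.Bundles using (_⇔_; mk⇔)
open import Function.Definitions using (Injective; StrictlySurjective)
open import Relation.Binary using (Rel; DecidableEquality; tri<; tri≈; tri>)
open import Relation.Binary.PropositionalEquality
open import Relation.Binary.Construct.Closure.ReflexiveTransitive
  using (Star; ε; _◅_; _◅◅_; reverse)
open import Relation.Nullary using (¬_; yes; no; contradiction)
open import Relation.Nullary.Decidable using (Dec; ¬?; decidable-stable; map′)
open import Relation.Unary using (Pred; Decidable)

open import Defs hiding (sym)

∃⟶∃-smallest : ∀ {N p} {P : Pred (Fin N) p} → Decidable P → ∃ P →
               ∃ λ i → P i × (∀ {j} → P j → toℕ i ≤ toℕ j)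
∃⟶∃-smallest {N} {P = P} P? (i , pᵢ)
  with ¬∀⟶∃¬-smallest N (¬_ ∘ P) (¬? ∘ P?) (λ ¬P → ¬P i pᵢ)
... | k , ¬¬pₖ , below = k , decidable-stable (P? k) ¬¬pₖ , λ {j} pⱼ →
  ≮⇒≥ λ j<k → below (fromℕ< j<k)
    (subst P (toℕ-injective (sym (trans (toℕ-inject (fromℕ< j<k)) (toℕ-fromℕ< j<k)))) pⱼ)

injective⇒strictlySurjective : ∀ {N} {f : Fin N → Fin N} →
  Injective _≡_ _≡_ f → StrictlySurjective _≡_ f
injective⇒strictlySurjective {zero} _ ()
injective⇒strictlySurjective {suc N} {f} f-inj y with any? (λ x → f x ≟ᶠ y)
... | yes hit = hit
... | no miss with pigeonhole (n<1+n N) (λ x → punchOut {i = y} (miss ∘ (x ,_) ∘ sym))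
...   | i , j , i<j , e =
  contradiction (f-inj (punchOut-injective (miss ∘ (i ,_) ∘ sym) (miss ∘ (j ,_) ∘ sym) e))
                (<⇒≢ᶠ i<j)

lookup-injective : ∀ {A : Set} {xs : List A} → Unique xs →
                   ∀ {i j} → lookup xs i ≡ lookup xs j → i ≡ j
lookup-injective (_ ∷ _)    {fzero}  {fzero}  _ = refl
lookup-injective (x≢ ∷ _)   {fzero}  {fsuc j} e = contradiction e (All.lookup x≢ (∈-lookup j))
lookup-injective (x≢ ∷ _)   {fsuc i} {fzero}  e = contradiction (sym e) (All.lookup x≢ (∈-lookup i))
lookup-injective (_ ∷ uniq) {fsuc i} {fsuc j} e = cong fsuc (lookup-injective uniq e)

module _ {A : Set} {R : Rel A 0ℓ} where

  linked⇒star : ∀ {k} (w : Fin (suc k) → A) →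
                (∀ i → R (w (inject₁ i)) (w (fsuc i))) → ∀ t → Star R (w fzero) (w t)
  linked⇒star         w r fzero    = ε
  linked⇒star {suc k} w r (fsuc t) = r fzero ◅ linked⇒star (w ∘ fsuc) (r ∘ fsuc) t

  -- For R = Adj G this is literally Path G.
  SimplePath : A → A → ℕ → Set
  SimplePath u v k =
    Σ (Fin (suc k) → A) λ w →
      Injective _≡_ _≡_ w × (w fzero ≡ u) × (w (fromℕ k) ≡ v) ×
      (∀ i → R (w (inject₁ i)) (w (fsuc i)))

  private
    tail : ∀ {u v k} ((w , _) : SimplePath u v (suc k)) → SimplePath (w (fsuc fzero)) v k
    tail (w , inj , _ , end , r) = w ∘ fsuc , fsuc-injective ∘ inj , refl , end , r ∘ fsuc

    suffix : ∀ {u v k} ((w , _) : SimplePath u v k) j → ∃[ k′ ] SimplePath (w j) v k′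
    suffix         (w , inj , _ , end , r) fzero    = _ , w , inj , refl , end , r
    suffix {k = suc k} P                   (fsuc j) = suffix (tail P) j

    cons : ∀ {u x v k} → R u x → ((w , _) : SimplePath x v k) → (∀ i → w i ≢ u) →
           SimplePath u v (suc k)
    cons {u} r (w , inj , start , end , rs) u∉w = w′ , inj′ , refl , end , rs′
      where
        w′ : Fin (suc (suc _)) → A
        w′ fzero    = u
        w′ (fsuc i) = w i
        inj′ : Injective _≡_ _≡_ w′
        inj′ {fzero}  {fzero}  _ = refl
        inj′ {fzero}  {fsuc j} e = contradiction (sym e) (u∉w j)
        inj′ {fsuc i} {fzero}  e = contradiction e (u∉w i)
        inj′ {fsuc i} {fsuc j} e = cong fsuc (inj e)
        rs′ : ∀ i → R (w′ (inject₁ i)) (w′ (fsuc i))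
        rs′ fzero    = subst (R u) (sym start) r
        rs′ (fsuc i) = rs i

  -- A vertex already on the path cuts the path back to the suffix starting there.
  star⇒simplePath : DecidableEquality A → ∀ {u v} → Star R u v → ∃[ k ] SimplePath u v k
  star⇒simplePath _≟_ {u} ε =
    0 , (λ _ → u) , (λ { {fzero} {fzero} _ → refl }) , refl , refl , λ ()
  star⇒simplePath _≟_ {u} (r ◅ rs) with star⇒simplePath _≟_ rs
  ... | k , P@(w , _) with any? (λ i → w i ≟ u)
  ...   | yes (j , wⱼ≡u) = subst (λ x → ∃[ k′ ] SimplePath x _ k′) wⱼ≡u (suffix P j)
  ...   | no u∉w = suc k , cons r P (λ i e → u∉w (i , e))

module Orbits {N : ℕ} (σ : Fin N → Fin N) (σ-injective : Injective _≡_ _≡_ σ) where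

  σ^ : ℕ → Fin N → Fin N
  σ^ r x = fold x σ r

  σ^-+ : ∀ r s x → σ^ (r + s) x ≡ σ^ r (σ^ s x)
  σ^-+ r s x = fold-+ x σ r

  σ^-injective : ∀ r → Injective _≡_ _≡_ (σ^ r)
  σ^-injective zero    e = e
  σ^-injective (suc r) e = σ^-injective r (σ-injective e)

  σ^-cancel : ∀ r d {x} → σ^ r x ≡ σ^ (r + d) x → x ≡ σ^ d x
  σ^-cancel r d {x} e = σ^-injective r (trans e (σ^-+ r d x))

  σ^-multiple : ∀ {p x} → σ^ p x ≡ x → ∀ q → σ^ (q * p) x ≡ x
  σ^-multiple         e zero    = refl
  σ^-multiple {p} {x} e (suc q) = begin
    σ^ (p + q * p) x   ≡⟨ σ^-+ p (q * p) x ⟩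
    σ^ p (σ^ (q * p) x) ≡⟨ cong (σ^ p) (σ^-multiple e q) ⟩
    σ^ p x             ≡⟨ e ⟩
    x                  ∎
    where open ≡-Reasoning

  σ^-mod : ∀ p {x} .{{_ : NonZero p}} → σ^ p x ≡ x → ∀ r → σ^ r x ≡ σ^ (r % p) x
  σ^-mod p {x} e r = begin
    σ^ r x                               ≡⟨ cong (λ s → σ^ s x) (m≡m%n+[m/n]*n r p) ⟩
    σ^ (r % p + r / p * p) x             ≡⟨ σ^-+ (r % p) (r / p * p) x ⟩
    σ^ (r % p) (σ^ (r / p * p) x)        ≡⟨ cong (σ^ (r % p)) (σ^-multiple e (r / p)) ⟩
    σ^ (r % p) x                         ∎
    where open ≡-Reasoning

  σ^-collision : ∀ {a b x} → a < b → σ^ a x ≡ σ^ b x →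
                 ∃[ d ] (suc d ≤ b × σ^ (suc d) x ≡ x)
  σ^-collision {a} {b} {x} a<b e with m≤n⇒∃[o]m+o≡n a<b
  ... | d , a+1+d≡b =
    d , subst (suc d ≤_) a+1+d≡b (s≤s (m≤n+m d a)) ,
    sym (σ^-cancel a (suc d) (trans e (cong (λ s → σ^ s x) (trans (sym a+1+d≡b) (sym (+-suc a d))))))

  -- Pigeonhole on x, σ x, …, σ^N x.
  σ^-returns : ∀ x → ∃[ d ] (d < N × σ^ (suc d) x ≡ x)
  σ^-returns x with pigeonhole (n<1+n N) (λ i → σ^ (toℕ i) x)
  ... | i , j , i<j , e with σ^-collision i<j e
  ...   | d , d<j , returns = d , ≤-trans d<j (≤-pred (toℕ<n j)) , returns

  record IsPeriod (x : Fin N) (p : ℕ) : Set where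
    field
      returns : σ^ p x ≡ x
      minimal : ∀ {d} → suc d < p → σ^ (suc d) x ≢ x

  private
    Returns : Fin N → Fin N → Set
    Returns x d = σ^ (suc (toℕ d)) x ≡ x

    firstReturn : ∀ x →
                  ∃ λ d → Returns x d × (∀ {d′} → Returns x d′ → toℕ d ≤ toℕ d′)
    firstReturn x with σ^-returns x
    ... | d , d<N , e = ∃⟶∃-smallest (λ d → σ^ (suc (toℕ d)) x ≟ᶠ x)
                          (fromℕ< d<N , subst (λ s → σ^ (suc s) x ≡ x) (sym (toℕ-fromℕ< d<N)) e)

  -- Abstract: unfolding the searches behind period and rep makes type checking blow up.
  abstract
    period : Fin N → ℕ
    period x = suc (toℕ (proj₁ (firstReturn x)))

    period-positive : ∀ x → 1 ≤ period x
    period-positive x = s≤s z≤n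

    period≤N : ∀ x → period x ≤ N
    period≤N x = toℕ<n (proj₁ (firstReturn x))

    period-isPeriod : ∀ x → IsPeriod x (period x)
    period-isPeriod x = record { returns = proj₁ (proj₂ (firstReturn x)) ; minimal = minimal }
      where
        minimal : ∀ {d} → suc d < period x → σ^ (suc d) x ≢ x
        minimal {d} (s≤s d<r) e =
          <⇒≱ d<r (subst (_ ≤_) (toℕ-fromℕ< d<N) (proj₂ (proj₂ (firstReturn x)) returns))
          where
            d<N : d < N
            d<N = <-trans d<r (period≤N x)
            returns : Returns x (fromℕ< d<N)
            returns = subst (λ s → σ^ (suc s) x ≡ x) (sym (toℕ-fromℕ< d<N)) e

  instance
    period-nonZero : ∀ {x} → NonZero (period x)
    period-nonZero {x} = >-nonZero (period-positive x)

  period-returns : ∀ x → σ^ (period x) x ≡ x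
  period-returns x = IsPeriod.returns (period-isPeriod x)

  infix 4 _∼_
  _∼_ : Fin N → Fin N → Set
  x ∼ y = ∃[ r ] σ^ r x ≡ y

  ∼-refl : ∀ {x} → x ∼ x
  ∼-refl = 0 , refl

  ∼-trans : ∀ {x y z} → x ∼ y → y ∼ z → x ∼ z
  ∼-trans {x} (r , refl) (s , refl) = s + r , σ^-+ s r x

  ∼-below-period : ∀ {x y} → x ∼ y → ∃[ r ] (r < period x × σ^ r x ≡ y)
  ∼-below-period {x} (r , refl) =
    r % period x , m%n<n r (period x) , sym (σ^-mod (period x) (period-returns x) r)

  ∼-sym : ∀ {x y} → x ∼ y → y ∼ x
  ∼-sym {x} x∼y with ∼-below-period x∼y
  ... | r , r<p , refl = period x ∸ r , (begin
    σ^ (period x ∸ r) (σ^ r x) ≡⟨ sym (σ^-+ (period x ∸ r) r x) ⟩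
    σ^ (period x ∸ r + r) x    ≡⟨ cong (λ s → σ^ s x) (m∸n+n≡m (<⇒≤ r<p)) ⟩
    σ^ (period x) x            ≡⟨ period-returns x ⟩
    x                          ∎)
    where open ≡-Reasoning

  _∼?_ : ∀ x y → Dec (x ∼ y)
  x ∼? y = map′ (λ (r , _ , e) → r , e) bounded (anyUpTo? (λ r → σ^ r x ≟ᶠ y) N)
    where
      bounded : x ∼ y → ∃[ r ] (r < N × σ^ r x ≡ y)
      bounded x∼y with ∼-below-period x∼y
      ... | r , r<p , e = r , <-≤-trans r<p (period≤N x) , e

  abstract
    rep : Fin N → Fin N
    rep x = proj₁ (∃⟶∃-smallest (x ∼?_) (x , ∼-refl))

    rep-∼ : ∀ x → x ∼ rep x
    rep-∼ x = proj₁ (proj₂ (∃⟶∃-smallest (x ∼?_) (x , ∼-refl)))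

    rep-least : ∀ {x z} → x ∼ z → toℕ (rep x) ≤ toℕ z
    rep-least {x} = proj₂ (proj₂ (∃⟶∃-smallest (x ∼?_) (x , ∼-refl)))

  rep-cong : ∀ {x y} → x ∼ y → rep x ≡ rep y
  rep-cong {x} {y} x∼y = toℕ-injective (≤-antisym
    (rep-least (∼-trans x∼y (rep-∼ y)))
    (rep-least (∼-trans (∼-sym x∼y) (rep-∼ x))))

next-injective : ∀ {k} → Injective _≡_ _≡_ (next {k})
next-injective {k} {i} {j} e = toℕ-injective (begin
  toℕ i                                  ≡⟨ unshift (toℕ<n i) ⟩
  (k % suc k + suc (toℕ i) % suc k) % suc k ≡⟨ cong (λ s → (k % suc k + s) % suc k) e′ ⟩
  (k % suc k + suc (toℕ j) % suc k) % suc k ≡⟨ sym (unshift (toℕ<n j)) ⟩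
  toℕ j                                  ∎)
  where
    open ≡-Reasoning
    e′ : suc (toℕ i) % suc k ≡ suc (toℕ j) % suc k
    e′ = trans (sym (toℕ-fromℕ< (m%n<n (suc (toℕ i)) (suc k))))
               (trans (cong toℕ e) (toℕ-fromℕ< (m%n<n (suc (toℕ j)) (suc k))))
    -- adding k ≡ -1 (mod k + 1) undoes the successor
    unshift : ∀ {a} → a < suc k → a ≡ (k % suc k + suc a % suc k) % suc k
    unshift {a} a<k+1 = begin
      a                              ≡⟨ sym (m<n⇒m%n≡m a<k+1) ⟩
      a % suc k                      ≡⟨ sym ([m+n]%n≡m%n a (suc k)) ⟩
      (a + suc k) % suc k            ≡⟨ cong (_% suc k) (trans (+-suc a k) (cong suc (+-comm a k))) ⟩
      suc (k + a) % suc k            ≡⟨ cong (_% suc k) (sym (+-suc k a)) ⟩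
      (k + suc a) % suc k            ≡⟨ %-distribˡ-+ k (suc a) (suc k) ⟩
      (k % suc k + suc a % suc k) % suc k ∎

record Move (G : Graph) : Set where
  field
    step           : V G → V G
    step-injective : Injective _≡_ _≡_ step
    step-adjacent  : ∀ x → Adj G x (step x)

open Move public

module _ (G : Graph) where

  adj-irrefl : ∀ {x y} → Adj G x y → x ≢ y
  adj-irrefl {x} a refl with trans (sym a) (irrefl G x)
  ... | ()

  adj-sym : ∀ {x y} → Adj G x y → Adj G y x
  adj-sym {x} {y} a = trans (Graph.sym G y x) a

  edgeOf-sym : ∀ (P : Piece G) {x y} → EdgeOf P x y → EdgeOf P y x
  edgeOf-sym (edgeP _ _ _)    (inj₁ (p , q))     = inj₂ (q , p)
  edgeOf-sym (edgeP _ _ _)    (inj₂ (p , q))     = inj₁ (q , p)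
  edgeOf-sym (cycleP _ _ _ _) (i , inj₁ (p , q)) = i , inj₂ (p , q)
  edgeOf-sym (cycleP _ _ _ _) (i , inj₂ (p , q)) = i , inj₁ (p , q)

  successor : ∀ (P : Piece G) {x} → VertexOf P x → V G
  successor (edgeP u v _)    (inj₁ _) = v
  successor (edgeP u v _)    (inj₂ _) = u
  successor (cycleP _ c _ _) (i , _)  = c (next i)

  successor-∈ : ∀ (P : Piece G) {x} (x∈P : VertexOf P x) → VertexOf P (successor P x∈P)
  successor-∈ (edgeP _ _ _)    (inj₁ _) = inj₂ refl
  successor-∈ (edgeP _ _ _)    (inj₂ _) = inj₁ refl
  successor-∈ (cycleP _ _ _ _) (i , _)  = next i , refl

  successor-adjacent : ∀ (P : Piece G) {x} (x∈P : VertexOf P x) → Adj G x (successor P x∈P)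
  successor-adjacent (edgeP _ _ a)     (inj₁ refl)  = a
  successor-adjacent (edgeP _ _ a)     (inj₂ refl)  = adj-sym a
  successor-adjacent (cycleP _ _ _ as) (i , refl)   = as i

  successor-unique : ∀ (P : Piece G) {x} (p q : VertexOf P x) → successor P p ≡ successor P q
  successor-unique (edgeP _ _ _)    (inj₁ _) (inj₁ _) = refl
  successor-unique (edgeP _ _ a)    (inj₁ p) (inj₂ q) = contradiction (trans (sym p) q) (adj-irrefl a)
  successor-unique (edgeP _ _ a)    (inj₂ p) (inj₁ q) = contradiction (trans (sym q) p) (adj-irrefl a)
  successor-unique (edgeP _ _ _)    (inj₂ _) (inj₂ _) = refl
  successor-unique (cycleP _ c c-inj _) (i , p) (j , q) = cong (c ∘ next) (c-inj (trans p (sym q)))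

  successor-injective : ∀ (P : Piece G) {x y} (p : VertexOf P x) (q : VertexOf P y) →
                        successor P p ≡ successor P q → x ≡ y
  successor-injective (edgeP _ _ _) (inj₁ p) (inj₁ q) _ = trans p (sym q)
  successor-injective (edgeP _ _ a) (inj₁ _) (inj₂ _) e = contradiction (sym e) (adj-irrefl a)
  successor-injective (edgeP _ _ a) (inj₂ _) (inj₁ _) e = contradiction e (adj-irrefl a)
  successor-injective (edgeP _ _ _) (inj₂ p) (inj₂ q) _ = trans p (sym q)
  successor-injective (cycleP _ c c-inj _) (i , refl) (j , refl) e =
    cong c (next-injective (c-inj e))

  edgeOf⇒successor : ∀ (P : Piece G) {x y} → EdgeOf P x y →
    (Σ (VertexOf P x) λ p → successor P p ≡ y) ⊎ (Σ (VertexOf P y) λ q → successor P q ≡ x)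
  edgeOf⇒successor (edgeP _ _ _)    (inj₁ (p , q))     = inj₁ (inj₁ p , sym q)
  edgeOf⇒successor (edgeP _ _ _)    (inj₂ (p , q))     = inj₁ (inj₂ p , sym q)
  edgeOf⇒successor (cycleP _ _ _ _) (i , inj₁ (p , q)) = inj₁ ((i , p) , q)
  edgeOf⇒successor (cycleP _ _ _ _) (i , inj₂ (p , q)) = inj₂ ((i , p) , q)

  module Rotation (S : Cover G) where
    open Cover S

    rotate : V G → V G
    rotate x = successor (piece (proj₁ (covering x))) (proj₂ (covering x))

    rotate-piece : ∀ j {x} (x∈j : VertexOf (piece j) x) → rotate x ≡ successor (piece j) x∈j
    rotate-piece j {x} x∈j with disjoint (proj₁ (covering x)) j x (proj₂ (covering x)) x∈j
    ... | refl = successor-unique (piece j) (proj₂ (covering x)) x∈j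

    rotate-injective : Injective _≡_ _≡_ rotate
    rotate-injective {x} {y} e =
      successor-injective (piece i) (proj₂ (covering x)) y∈i (trans e (rotate-piece i y∈i))
      where
        i j : Fin m
        i = proj₁ (covering x)
        j = proj₁ (covering y)
        y∈j : VertexOf (piece j) y
        y∈j = proj₂ (covering y)
        i≡j : i ≡ j
        i≡j = disjoint i j (rotate x) (successor-∈ (piece i) (proj₂ (covering x)))
                (subst (VertexOf (piece j)) (sym e) (successor-∈ (piece j) y∈j))
        y∈i : VertexOf (piece i) y
        y∈i = subst (λ k → VertexOf (piece k) y) (sym i≡j) y∈j

    rotate-edge : ∀ j {x y} → EdgeOf (piece j) x y → rotate x ≡ y ⊎ rotate y ≡ x
    rotate-edge j xy with edgeOf⇒successor (piece j) xy
    ... | inj₁ (x∈j , e) = inj₁ (trans (rotate-piece j x∈j) e)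
    ... | inj₂ (y∈j , e) = inj₂ (trans (rotate-piece j y∈j) e)

  coverMove : Cover G → Move G
  coverMove S = record
    { step           = rotate
    ; step-injective = rotate-injective
    ; step-adjacent  = λ x → successor-adjacent _ (proj₂ (Cover.covering S x))
    }
    where open Rotation S

  transition : ∀ (g h : V G → V G) → Injective _≡_ _≡_ g → Injective _≡_ _≡_ h →
               (∀ a → Adj G (g a) (h a)) → Σ (Move G) λ m → ∀ a → step m (g a) ≡ h a
  transition g h g-inj h-inj adj =
    record { step = h ∘ g⁻¹ ; step-injective = inj ; step-adjacent = adjacent } ,
    λ a → cong h (g-inj (g∘g⁻¹ (g a)))
    where
      g⁻¹ : V G → V G
      g⁻¹ y = proj₁ (injective⇒strictlySurjective g-inj y)
      g∘g⁻¹ : ∀ y → g (g⁻¹ y) ≡ y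
      g∘g⁻¹ y = proj₂ (injective⇒strictlySurjective g-inj y)
      inj : Injective _≡_ _≡_ (h ∘ g⁻¹)
      inj {x} {y} e = trans (sym (g∘g⁻¹ x)) (trans (cong g (h-inj e)) (g∘g⁻¹ y))
      adjacent : ∀ x → Adj G x (h (g⁻¹ x))
      adjacent x = subst (λ y → Adj G y (h (g⁻¹ x))) (g∘g⁻¹ x) (adj (g⁻¹ x))

  inverse : ∀ (m : Move G) → Σ (Move G) λ m⁻¹ → ∀ a → step m⁻¹ (step m a) ≡ a
  inverse m = transition (step m) id (step-injective m) id (adj-sym ∘ step-adjacent m)

  OneMove : V G → V G → Set
  OneMove x y = Σ (Move G) λ m → step m x ≡ y

  coverEdge⇒oneMove : ∀ {x y} → EdgeInSomeCover G x y → OneMove x y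
  coverEdge⇒oneMove {y = y} (S , j , xy) with Rotation.rotate-edge S j xy
  ... | inj₁ e = coverMove S , e
  ... | inj₂ e with inverse (coverMove S)
  ...   | m⁻¹ , m⁻¹-undoes = m⁻¹ , trans (cong (step m⁻¹) (sym e)) (m⁻¹-undoes y)

  module OrbitCover (m : Move G) where
    open Orbits (step m) (step-injective m)

    private
      σ : V G → V G
      σ = step m

    period≥2 : ∀ y → 2 ≤ period y
    period≥2 y = ≰⇒> λ period≤1 → adj-irrefl (step-adjacent m y) (sym
      (subst (λ p → σ^ p y ≡ y) (≤-antisym period≤1 (period-positive y)) (period-returns y)))

    ∼⇒index : ∀ p {y z} .{{_ : NonZero p}} → σ^ p y ≡ y → y ∼ z →
              ∃ λ (i : Fin p) → σ^ (toℕ i) y ≡ z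
    ∼⇒index p {y} returns (r , refl) =
      fromℕ< (m%n<n r p) ,
      trans (cong (λ s → σ^ s y) (toℕ-fromℕ< (m%n<n r p))) (sym (σ^-mod p returns r))


    σ^-distinct : ∀ {y p} → IsPeriod y p → ∀ {a b} → a < b → b < p → σ^ a y ≢ σ^ b y
    σ^-distinct per a<b b<p e with σ^-collision a<b e
    ... | d , d<b , returns = IsPeriod.minimal per (<-≤-trans (s≤s d<b) b<p) returns

    σ^-next : ∀ k {y} → σ^ (suc k) y ≡ y → ∀ (i : Fin (suc k)) →
              σ^ (toℕ (next i)) y ≡ σ (σ^ (toℕ i) y)
    σ^-next k {y} returns i = begin
      σ^ (toℕ (next i)) y
        ≡⟨ cong (λ s → σ^ s y) (toℕ-fromℕ< (m%n<n (suc (toℕ i)) (suc k))) ⟩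
      σ^ (suc (toℕ i) % suc k) y
        ≡⟨ sym (σ^-mod (suc k) returns (suc (toℕ i))) ⟩
      σ (σ^ (toℕ i) y)
        ∎
      where open ≡-Reasoning

    orbitPiece : ∀ y k → IsPeriod y (2 + k) → Piece G
    orbitPiece y zero    _   = edgeP y (σ y) (step-adjacent m y)
    orbitPiece y (suc k) per = cycleP k (λ i → σ^ (toℕ i) y) c-inj c-adj
      where
        c-inj : Injective _≡_ _≡_ (λ (i : Fin (3 + k)) → σ^ (toℕ i) y)
        c-inj {i} {j} e with <-cmp (toℕ i) (toℕ j)
        ... | tri< i<j _ _ = contradiction e (σ^-distinct per i<j (toℕ<n j))
        ... | tri≈ _ i≡j _ = toℕ-injective i≡j
        ... | tri> _ _ j<i = contradiction (sym e) (σ^-distinct per j<i (toℕ<n i))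
        c-adj : ∀ i → Adj G (σ^ (toℕ i) y) (σ^ (toℕ (next i)) y)
        c-adj i = subst (Adj G (σ^ (toℕ i) y)) (sym (σ^-next (2 + k) (IsPeriod.returns per) i))
                        (step-adjacent m _)

    orbitPiece-vertex⁻ : ∀ {y} k {per : IsPeriod y (2 + k)} {z} →
                         VertexOf (orbitPiece y k per) z → y ∼ z
    orbitPiece-vertex⁻ zero    (inj₁ refl) = 0 , refl
    orbitPiece-vertex⁻ zero    (inj₂ refl) = 1 , refl
    orbitPiece-vertex⁻ (suc k) (i , e)     = toℕ i , e

    orbitPiece-vertex⁺ : ∀ {y} k {per : IsPeriod y (2 + k)} {z} →
                         y ∼ z → VertexOf (orbitPiece y k per) z
    orbitPiece-vertex⁺ zero {per} y∼z with ∼⇒index 2 (IsPeriod.returns per) y∼z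
    ... | fzero      , e = inj₁ (sym e)
    ... | fsuc fzero , e = inj₂ (sym e)
    orbitPiece-vertex⁺ (suc k) {per} y∼z = ∼⇒index (3 + k) (IsPeriod.returns per) y∼z

    orbitPiece-edge : ∀ {y} k {per : IsPeriod y (2 + k)} {z} →
                      y ∼ z → EdgeOf (orbitPiece y k per) z (σ z)
    orbitPiece-edge zero {per} y∼z with ∼⇒index 2 (IsPeriod.returns per) y∼z
    ... | fzero      , refl = inj₁ (refl , refl)
    ... | fsuc fzero , refl = inj₂ (refl , IsPeriod.returns per)
    orbitPiece-edge (suc k) {per} y∼z with ∼⇒index (3 + k) (IsPeriod.returns per) y∼z
    ... | i , e = i , inj₁ (e , trans (σ^-next (2 + k) (IsPeriod.returns per) i) (cong σ e))

    orbitOf : V G → Piece G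
    orbitOf y = orbitPiece y (period y ∸ 2)
      (subst (IsPeriod y) (sym (m+[n∸m]≡n (period≥2 y))) (period-isPeriod y))

    reps : List (V G)
    reps = filter (λ y → rep y ≟ᶠ y) (allFin (n G))

    orbitCover : Cover G
    orbitCover = record
      { m        = length reps
      ; piece    = orbitOf ∘ lookup reps
      ; covering = covering
      ; disjoint = disjoint
      }
      where
        covering : ∀ x → ∃[ i ] VertexOf (orbitOf (lookup reps i)) x
        covering x = index rep∈reps ,
          orbitPiece-vertex⁺ (period _ ∸ 2)
            (subst (_∼ x) (lookup-result rep∈reps) (∼-sym (rep-∼ x)))
          where
            rep∈reps : rep x ∈ reps
            rep∈reps =
              ∈-filter⁺ (λ y → rep y ≟ᶠ y) (∈-allFin (rep x)) (sym (rep-cong (rep-∼ x)))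
        disjoint : ∀ i j x → VertexOf (orbitOf (lookup reps i)) x →
                   VertexOf (orbitOf (lookup reps j)) x → i ≡ j
        disjoint i j x x∈i x∈j =
          lookup-injective (filter⁺ (λ y → rep y ≟ᶠ y) (allFin⁺ (n G))) (begin
          lookup reps i       ≡⟨ sym (is-rep i) ⟩
          rep (lookup reps i) ≡⟨ rep-cong (∼-trans (orbitPiece-vertex⁻ _ x∈i)
                                                   (∼-sym (orbitPiece-vertex⁻ _ x∈j))) ⟩
          rep (lookup reps j) ≡⟨ is-rep j ⟩
          lookup reps j       ∎)
          where
            open ≡-Reasoning
            is-rep : ∀ i → rep (lookup reps i) ≡ lookup reps i
            is-rep i = proj₂ (∈-filter⁻ (λ y → rep y ≟ᶠ y) {xs = allFin (n G)} (∈-lookup i))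

    move-edge-in-cover : ∀ z → EdgeInSomeCover G z (σ z)
    move-edge-in-cover z = orbitCover , i , orbitPiece-edge _ (orbitPiece-vertex⁻ _ z∈i)
      where
        i : Fin (Cover.m orbitCover)
        i = proj₁ (Cover.covering orbitCover z)
        z∈i : VertexOf (Cover.piece orbitCover i) z
        z∈i = proj₂ (Cover.covering orbitCover z)

  walk₀⇒≡ : ∀ {x y} → Walk G x y 0 → x ≡ y
  walk₀⇒≡ (_ , start , end , _) = trans (sym start) end

  isDist-refl : ∀ {x} → IsDist G x x 0
  isDist-refl {x} = ((λ _ → x) , refl , refl , λ ()) , λ _ _ → z≤n

  adjacent⇒isDist1 : ∀ {x y} → Adj G x y → IsDist G x y 1
  adjacent⇒isDist1 {x} {y} a = (w , refl , refl , λ { fzero → a }) , shortest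
    where
      w : Fin 2 → V G
      w fzero    = x
      w (fsuc _) = y
      shortest : ∀ k → Walk G x y k → 1 ≤ k
      shortest zero    walk = contradiction (walk₀⇒≡ walk) (adj-irrefl a)
      shortest (suc _) _    = s≤s z≤n

  edge-exists : Connected G → 2 ≤ n G → ∃₂ λ x y → Adj G x y
  edge-exists conn 2≤n with conn (fromℕ< {0} (<-trans z<s 2≤n)) (fromℕ< {1} 2≤n)
  ... | zero  , walk = contradiction (cong toℕ (walk₀⇒≡ walk)) λ e →
    0≢1+n (trans (sym (toℕ-fromℕ< (<-trans z<s 2≤n))) (trans e (toℕ-fromℕ< 2≤n)))
  ... | suc _ , w , _ , _ , adj = w fzero , w (fsuc fzero) , adj fzero

  slice-injective : ∀ {c ℓ} (F : Fin c → Fin (suc ℓ) → V G) → MinDist G F 1 →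
                    ∀ t → Injective _≡_ _≡_ (λ i → F i t)
  slice-injective F (separated , _) t {i} {j} e with i ≟ᶠ j
  ... | yes i≡j = i≡j
  ... | no  i≢j with separated i j i≢j t 0 (subst (λ v → IsDist G (F i t) v 0) e isDist-refl)
  ...   | ()

  achievable⇒≤n : ∀ {c} → Achievable1 G c → c ≤ n G
  achievable⇒≤n (_ , _ , F , md) = injective⇒≤ (slice-injective (λ i → proj₁ (F i)) md fzero)

  -- Where x stands after the first t moves (t beyond the length of the schedule acts as its length).
  pos : List (Move G) → ℕ → V G → V G
  pos ms       zero    x = x
  pos []       (suc t) x = x
  pos (m ∷ ms) (suc t) x = pos ms t (step m x)

  run : List (Move G) → V G → V G
  run ms = pos ms (length ms)

  pos-++ˡ : ∀ ms ms′ {t} x → t ≤ length ms → pos (ms ++ ms′) t x ≡ pos ms t x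
  pos-++ˡ ms       ms′ {zero}  x _        = refl
  pos-++ˡ (m ∷ ms) ms′ {suc t} x (s≤s t≤) = pos-++ˡ ms ms′ (step m x) t≤

  pos-++ʳ : ∀ ms ms′ t x → pos (ms ++ ms′) (length ms + t) x ≡ pos ms′ t (run ms x)
  pos-++ʳ []       ms′ t x = refl
  pos-++ʳ (m ∷ ms) ms′ t x = pos-++ʳ ms ms′ t (step m x)

  pos-injective : ∀ ms t → Injective _≡_ _≡_ (pos ms t)
  pos-injective ms       zero    e = e
  pos-injective []       (suc t) e = e
  pos-injective (m ∷ ms) (suc t) e = step-injective m (pos-injective ms t e)

  pos-adjacent : ∀ ms t x → t < length ms → Adj G (pos ms t x) (pos ms (suc t) x)
  pos-adjacent (m ∷ ms) zero    x _        = step-adjacent m x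
  pos-adjacent (m ∷ ms) (suc t) x (s≤s t<) = pos-adjacent ms t (step m x) t<

  star⇒schedule : ∀ {x y} → Star OneMove x y → ∃[ ms ] run ms x ≡ y
  star⇒schedule ε = [] , refl
  star⇒schedule ((m , refl) ◅ moves) with star⇒schedule moves
  ... | ms , arrives = m ∷ ms , arrives

  coverPath⇒schedule : CoverPathProperty G → ∀ x y → ∃[ ms ] run ms x ≡ y
  coverPath⇒schedule cpp x y with cpp x y
  ... | k , (w , _ , refl , refl , _) , in-cover =
    star⇒schedule (linked⇒star w (coverEdge⇒oneMove ∘ in-cover) (fromℕ k))

  Visits : List (Move G) → V G → V G → Set
  Visits ms a v = ∃[ t ] (t ≤ length ms × pos ms t a ≡ v)

  -- Meet each requirement in turn: extending a schedule keeps every earlier visit.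
  schedule : (∀ x y → ∃[ ms ] run ms x ≡ y) → ∀ (L : List (V G × V G)) →
             ∃[ ms ] (∀ {a v} → (a , v) ∈ L → Visits ms a v)
  schedule reach [] = [] , λ ()
  schedule reach ((a , v) ∷ L) with schedule reach L
  ... | ms , visits with reach (run ms a) v
  ...   | ms′ , arrives = ms ++ ms′ , λ
    { (here refl) → length ms + length ms′ , ≤-reflexive (sym (length-++ ms)) ,
                    trans (pos-++ʳ ms ms′ _ a) arrives
    ; (there p)   → let t , t≤ , e = visits p in
                    t , ≤-trans t≤ (≤-trans (m≤m+n _ _) (≤-reflexive (sym (length-++ ms)))) ,
                    trans (pos-++ˡ ms ms′ _ t≤) e
    }

  scheduleTrack : ∀ ms → (∀ a v → Visits ms a v) → V G → Track G (length ms)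
  scheduleTrack ms visits a = (λ t → pos ms (toℕ t) a) , onto , adjacent
    where
      onto : ∀ v → ∃ λ t → ∀ {s} → s ≡ t → pos ms (toℕ s) a ≡ v
      onto v with visits a v
      ... | t , t≤ , e =
        fromℕ< (s≤s t≤) ,
        λ { refl → trans (cong (λ s → pos ms s a) (toℕ-fromℕ< (s≤s t≤))) e }
      adjacent : ∀ i → Adj G (pos ms (toℕ (inject₁ i)) a) (pos ms (suc (toℕ i)) a)
      adjacent i = subst (λ s → Adj G (pos ms s a) (pos ms (suc (toℕ i)) a)) (sym (toℕ-inject₁ i))
                         (pos-adjacent ms (toℕ i) a (toℕ<n i))

  coverPath⇒achievable : Connected G → 2 ≤ n G → CoverPathProperty G → Achievable1 G (n G)
  coverPath⇒achievable conn 2≤n cpp = 2≤n , length B , scheduleTrack B visits , separated , touching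
    where
      all-pairs : List (V G × V G)
      all-pairs = cartesianProduct (allFin (n G)) (allFin (n G))
      B : List (Move G)
      B = proj₁ (schedule (coverPath⇒schedule cpp) all-pairs)
      visits : ∀ a v → Visits B a v
      visits a v = proj₂ (schedule (coverPath⇒schedule cpp) all-pairs)
                         (∈-cartesianProduct⁺ (∈-allFin a) (∈-allFin v))
      separated : ∀ i j → i ≢ j → ∀ t d →
                  IsDist G (pos B (toℕ t) i) (pos B (toℕ t) j) d → 1 ≤ d
      separated i j i≢j t zero    (walk , _) =
        contradiction (pos-injective B (toℕ t) (walk₀⇒≡ walk)) i≢j
      separated i j i≢j t (suc d) _          = s≤s z≤n
      touching : ∃[ i ] ∃[ j ] (i ≢ j × ∃[ t ] IsDist G (pos B (toℕ t) i) (pos B (toℕ t) j) 1)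
      touching with edge-exists conn 2≤n
      ... | x , y , a = x , y , adj-irrefl a , fzero , adjacent⇒isDist1 a

  CoverEdge : V G → V G → Set
  CoverEdge x y = Adj G x y × EdgeInSomeCover G x y

  coverEdge-sym : ∀ {x y} → CoverEdge x y → CoverEdge y x
  coverEdge-sym (a , S , j , xy) = adj-sym a , S , j , edgeOf-sym (Cover.piece S j) xy

  -- Between consecutive times the tour performs a move; its orbits form the cover.
  tour-step-coverEdge : ∀ {ℓ} (F : V G → Track G ℓ) → MinDist G (λ a → proj₁ (F a)) 1 →
                        ∀ a i → CoverEdge (proj₁ (F a) (inject₁ i)) (proj₁ (F a) (fsuc i))
  tour-step-coverEdge F md a i =
    proj₂ (proj₂ (F a)) i ,
    subst (EdgeInSomeCover G _) (proj₂ move a) (OrbitCover.move-edge-in-cover (proj₁ move) _)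
    where
      slice-inj : ∀ t → Injective _≡_ _≡_ (λ b → proj₁ (F b) t)
      slice-inj = slice-injective (λ b → proj₁ (F b)) md
      move : Σ (Move G) λ m → ∀ b → step m (proj₁ (F b) (inject₁ i)) ≡ proj₁ (F b) (fsuc i)
      move = transition _ _ (slice-inj (inject₁ i)) (slice-inj (fsuc i))
                         (λ b → proj₂ (proj₂ (F b)) i)

  tour⇒coverWalk : ∀ {ℓ} (F : V G → Track G ℓ) → MinDist G (λ a → proj₁ (F a)) 1 →
                   ∀ u v → Star CoverEdge u v
  tour⇒coverWalk F md u v = reverse coverEdge-sym (from-start u) ◅◅ from-start v
    where
      from-start : ∀ x → Star CoverEdge (proj₁ (F u) fzero) x
      from-start x with proj₁ (proj₂ (F u)) x
      ... | t , hits = subst (Star CoverEdge _) (hits refl)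
                         (linked⇒star (proj₁ (F u)) (tour-step-coverEdge F md u) t)

  simplePath⇒coverPath : ∀ {u v} → ∃[ k ] SimplePath {R = CoverEdge} u v k →
    ∃[ k ] Σ (Path G u v k) λ (w , _) → ∀ i → EdgeInSomeCover G (w (inject₁ i)) (w (fsuc i))
  simplePath⇒coverPath (k , w , inj , start , end , edges) =
    k , (w , inj , start , end , proj₁ ∘ edges) , proj₂ ∘ edges

  topfull⇒coverPath : DirectTopfull G → CoverPathProperty G
  topfull⇒coverPath (_ , (_ , _ , F , md) , _) u v =
    simplePath⇒coverPath (star⇒simplePath _≟ᶠ_ (tour⇒coverWalk F md u v))

theorem3p21 : (G : Graph) → Connected G → 2 ≤ n G →
    DirectTopfull G ⇔ CoverPathProperty G
theorem3p21 G conn 2≤n = mk⇔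
  (topfull⇒coverPath G)
  (λ cpp → conn , coverPath⇒achievable G conn 2≤n cpp , λ _ → achievable⇒≤n G)
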